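{- For every integer $n\ge 1$ and every integer $k\ge 0$: (a) $f_k(\mathcal{C}(G_{n+2}))=f_k(\mathcal{C}(G_{n+1}))+f_k(\mathcal{C}(G_n))+f_{k-1}(\mathcal{C}(G_n))$; (b) for $1\le i\le n$: $f_k(\mathcal{C}(G_{n+2,i}))=f_k(\mathcal{C}(G_{n+1,i}))+f_k(\mathcal{C}(G_{n,i}))+f_{k-1}(\mathcal{C}(G_{n,i}))$; (c) for $3\le i\le n+2$: $f_k(\mathcal{C}(G_{n+2,i}))=f_k(\mathcal{C}(G_{n+1,i-1}))+f_k(\mathcal{C}(G_{n,i-2}))+f_{k-1}(\mathcal{C}(G_{n,i-2}))$.
   Context: $G_n$ (the ladder graph) has vertices $(j,0),(j,1)$ for $j=0,\dots,n$ and edges $(j,a)(j+1,a)$ ($0\le j<n$, $a\in\{0,1\}$) and $(j,0)(j,1)$ ($0\le j\le n$), embedded in the plane in the obvious way; it has $2n+2$ vertices, $3n+1$ edges and $n$ unit squares, the $i$-th square having corners in columns $i-1,i$. For $1\le i\le n$, $G_{n,i}$ is obtained from $G_n$ by adding one unit square below the $i$-th square, i.e. adding vertices $(i-1,-1),(i,-1)$ and edges $(i-1,0)(i-1,-1)$, $(i-1,-1)(i,-1)$, $(i,-1)(i,0)$. For such a planar bipartite graph $G$, a tiling is a partition of its vertex set into blocks each being either an edge of $G$ or the vertex set of an elementary cycle (a cycle bounding a single bounded face, here a unit square); $\mathcal{C}(G)$ is the cubical complex of tilings, in which a tiling using exactly $k$ elementary cycles is a $k$-dimensional face. $f_k(\mathcal{C}(G))$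 denotes the number of $k$-dimensional faces, with $f_{ -1}=0$. -}

module Defs where

open import Data.Nat using (ℕ; zero; suc; _+_; _∸_; _<ᵇ_)
open import Data.Integer using (ℤ; +_; -[1+_])
open import Data.Bool using (Bool; true; false; if_then_else_; _∧_)
open import Data.List using (List; []; _∷_; _++_; map; length; concatMap; upTo; filter; sum)
open import Data.Bool.ListAction using (any)
open import Data.Bool.ListAction using (all)
open import Data.Vec using (Vec; []; _∷_)
open import Data.Product using (_×_; _,_)
open import Data.Product.Properties using (≡-dec)
open import Relation.Nullary.Decidable using (⌊_⌋)
import Data.Nat as ℕ
import Data.Integer as ℤ

-- Vertices are lattice points (column j, row a) of the plane.
Vertex : Set
Vertex = ℕ × ℤ

_=ᵛ_ : Vertex → Vertex → Bool
u =ᵛ v = ⌊ ≡-dec ℕ._≟_ ℤ._≟_ u v ⌋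

-- A (finite, plane, bipartite) graph given by its vertex list, its edge list
-- and the vertex sets of its elementary cycles (boundaries of bounded faces).
record PlaneGraph : Set where
  field
    vertices : List Vertex
    edges    : List (Vertex × Vertex)
    cycles   : List (List Vertex)
open PlaneGraph public

ladder : ℕ → PlaneGraph
ladder n = record
  { vertices = concatMap (λ j → (j , + 0) ∷ (j , + 1) ∷ []) (upTo (suc n))
  ; edges    = concatMap (λ j → ((j , + 0) , (suc j , + 0)) ∷ ((j , + 1) , (suc j , + 1)) ∷ []) (upTo n)
               ++ map (λ j → ((j , + 0) , (j , + 1))) (upTo (suc n))
  ; cycles   = map (λ i → (i , + 0) ∷ (suc i , + 0) ∷ (suc i , + 1) ∷ (i , + 1) ∷ []) (upTo n)
  }

-- G_{n,i}: G_n with one unit square added below its i-th square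
-- (the i-th square has corners in columns i-1, i).
ladderSq : ℕ → ℕ → PlaneGraph
ladderSq n i = record
  { vertices = vertices (ladder n) ++ ((i ∸ 1 , -[1+ 0 ]) ∷ (i , -[1+ 0 ]) ∷ [])
  ; edges    = edges (ladder n) ++
               (((i ∸ 1 , + 0) , (i ∸ 1 , -[1+ 0 ])) ∷ ((i ∸ 1 , -[1+ 0 ]) , (i , -[1+ 0 ]))
                 ∷ ((i , -[1+ 0 ]) , (i , + 0)) ∷ [])
  ; cycles   = cycles (ladder n) ++
               (((i ∸ 1 , -[1+ 0 ]) ∷ (i , -[1+ 0 ]) ∷ (i , + 0) ∷ (i ∸ 1 , + 0) ∷ []) ∷ [])
  }

allSel : (m : ℕ) → List (Vec Bool m)
allSel zero = [] ∷ []
allSel (suc m) = map (true ∷_) (allSel m) ++ map (false ∷_) (allSel m)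

select : {A : Set} (xs : List A) → Vec Bool (length xs) → List A
select [] [] = []
select (x ∷ xs) (b ∷ bs) = if b then x ∷ select xs bs else select xs bs

count : {A : Set} → (A → Bool) → List A → ℕ
count p xs = length (filter (λ x → Data.Bool.T? (p x)) xs)
  where import Data.Bool

-- A candidate tiling: a choice of a set of edges and a set of elementary cycles
-- (the blocks).  It is a tiling iff the blocks partition the vertex set, i.e.
-- every vertex lies in exactly one chosen block (blocks are nonempty and
-- automatically pairwise distinct as sets).
Choice : PlaneGraph → Set
Choice G = Vec Bool (length (edges G)) × Vec Bool (length (cycles G))

allChoices : (G : PlaneGraph) → List (Choice G)
allChoices G = concatMap (λ se → map (λ sc → se , sc) (allSel (length (cycles G))))
                         (allSel (length (edges G)))

inEdge : Vertex → Vertex × Vertex → Bool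
inEdge v (a , b) = (v =ᵛ a) Data.Bool.∨ (v =ᵛ b)

inCycle : Vertex → List Vertex → Bool
inCycle v c = any (v =ᵛ_) c

coverage : (G : PlaneGraph) → Choice G → Vertex → ℕ
coverage G (se , sc) v = count (inEdge v) (select (edges G) se)
                       + count (inCycle v) (select (cycles G) sc)

isTiling : (G : PlaneGraph) → Choice G → Bool
isTiling G c = all (λ v → ⌊ coverage G c v ℕ.≟ 1 ⌋) (vertices G)

dim : (G : PlaneGraph) → Choice G → ℕ
dim G (se , sc) = length (select (cycles G) sc)

-- f_k(C(G)): number of k-dimensional faces of the cubical complex of tilings
f : ℕ → PlaneGraph → ℕ
f k G = count (λ c → isTiling G c ∧ ⌊ dim G c ℕ.≟ k ⌋) (allChoices G)

-- f_{k-1}, with the convention f_{-1} = 0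
fPred : ℕ → PlaneGraph → ℕ
fPred zero G = 0
fPred (suc k) G = f k G

-- Sort the tilings of a ladder by how its end column {p, q} is covered: by the rung pq, by the
-- two rails joining it to the neighbouring column {a, b}, or by the end square.  Removing the
-- rung leaves a tiling of the ladder one column shorter; removing the rails or the square leaves
-- a tiling of that ladder in which a and b are already covered, with one square fewer in the
-- second case.  A tiling of a ladder whose end column is already covered cannot use any block
-- at that column, so it is a tiling of the ladder one column shorter still.  Peeling the right
-- end gives (a) and (b), the extra square lying further left; peeling the left end, after
-- shifting columns, gives (c).  To peel blocks one at a time we count the choices of blocks
-- that complete a given partial cover of the vertices.

module Submission where

open import Defs
import Algebra.Properties.CommutativeSemigroup as CommutativeSemigroupProperties
open import Data.Bool using (Bool; true; false; _∧_; _∨_; if_then_else_; T?)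
open import Data.Bool.ListAction using (and; or; all; any)
open import Data.Bool.Properties using (∨-comm; ∧-zeroʳ; ∧-isCommutativeMonoid)
open import Data.Bool.Solver using (module ∨-∧-Solver)
import Data.Integer as ℤ
open import Data.List using (List; []; _∷_; _++_; [_]; map; length; concatMap; upTo; applyUpTo)
open import Data.List.Membership.Propositional using (_∈_)
open import Data.List.Properties
  using (map-++; map-cong; map-cong-local; map-∘; length-map; ++-assoc; ++-identityʳ; upTo-∷ʳ; map-upTo;
         concatMap-++; concatMap-map; concatMap-cong; map-concatMap)
open import Data.List.Relation.Binary.Permutation.Propositional as ↭
  using (_↭_; ↭⇒↭ₛ; module PermutationReasoning)
open import Data.List.Relation.Binary.Permutation.Propositional.Properties
  using (map⁺; ↭-length; filter-↭; shift; shifts)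
open import Data.List.Relation.Binary.Permutation.Setoid.Properties using (foldr-commMonoid)
open import Data.List.Relation.Unary.All as All using (All; []; _∷_)
open import Data.List.Relation.Unary.All.Properties using (++⁺; concat⁺; applyUpTo⁺₁) renaming (map⁺ to All-map⁺)
open import Data.List.Relation.Unary.Any using (here; there)
import Data.Nat as ℕ
open import Data.Nat using (ℕ; zero; suc; _+_; _∸_; _≤_; _≟_; z≤n; s≤s)
open import Data.Nat.ListAction using (sum)
open import Data.Nat.ListAction.Properties using (sum-++)
open import Data.Nat.Properties
  using (+-comm; +-identityʳ; +-commutativeSemigroup; ≤-trans; ≤-pred; <⇒≤; n≤1+n; 1+n≰n; m∸n≤m)
open import Data.Nat.Tactic.RingSolver using (solve-∀)
import Data.Product as ×
open import Data.Product using (_×_; _,_; proj₁; proj₂)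
open import Data.Product.Properties using (≡-dec)
import Data.Vec as Vec
open import Function using (_∘_; id)
open import Function.Definitions using (Injective)
open import Relation.Binary.PropositionalEquality hiding ([_])
open import Relation.Nullary.Decidable using (Dec; yes; no; ⌊_⌋; isYes≗does; dec-true; dec-false)

open CommutativeSemigroupProperties +-commutativeSemigroup using (interchange; x∙yz≈yx∙z)

private
  variable
    A B : Set

toℕ : Bool → ℕ
toℕ true  = 1
toℕ false = 0

⌊suc≟suc⌋ : ∀ m n → ⌊ suc m ≟ suc n ⌋ ≡ ⌊ m ≟ n ⌋
⌊suc≟suc⌋ m n = trans (isYes≗does (suc m ≟ suc n)) (sym (isYes≗does (m ≟ n)))

count-∷ : ∀ (p : A → Bool) x xs → count p (x ∷ xs) ≡ toℕ (p x) + count p xs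
count-∷ p x xs with p x
... | true  = refl
... | false = refl

count≡sum : ∀ (p : A → Bool) xs → count p xs ≡ sum (map (toℕ ∘ p) xs)
count≡sum p []       = refl
count≡sum p (x ∷ xs) = trans (count-∷ p x xs) (cong (toℕ (p x) +_) (count≡sum p xs))

count-none : ∀ {p : A → Bool} {xs} → All (λ x → p x ≡ false) xs → count p xs ≡ 0
count-none []                         = refl
count-none {p = p} {x ∷ xs} (px ∷ pxs) = trans (count-∷ p x xs) (cong₂ (λ b n → toℕ b + n) px (count-none pxs))

count-↭ : ∀ (p : A → Bool) {xs ys} → xs ↭ ys → count p xs ≡ count p ys
count-↭ p xs↭ys = ↭-length (filter-↭ (λ x → T? (p x)) xs↭ys)

count-map : ∀ {p : A → Bool} {q : B → Bool} (g : B → A) → (∀ x → p (g x) ≡ q x) →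
            ∀ xs → count p (map g xs) ≡ count q xs
count-map g eq []       = refl
count-map {p = p} {q} g eq (x ∷ xs) = begin
  count p (g x ∷ map g xs)        ≡⟨ count-∷ p (g x) (map g xs) ⟩
  toℕ (p (g x)) + count p (map g xs) ≡⟨ cong₂ _+_ (cong toℕ (eq x)) (count-map g eq xs) ⟩
  toℕ (q x) + count q xs          ≡⟨ count-∷ q x xs ⟨
  count q (x ∷ xs)                ∎
  where open ≡-Reasoning

all-↭ : ∀ (p : A → Bool) {xs ys} → xs ↭ ys → all p xs ≡ all p ys
all-↭ p xs↭ys = foldr-commMonoid (setoid Bool) ∧-isCommutativeMonoid (↭⇒↭ₛ (map⁺ p xs↭ys))

all-false : ∀ {p : A → Bool} {x xs} → x ∈ xs → p x ≡ false → all p xs ≡ false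
all-false {p = p} {xs = _ ∷ ys} (here refl) px≡false = cong (_∧ all p ys) px≡false
all-false {p = p} {xs = y ∷ ys} (there x∈ys) px≡false =
  trans (cong (p y ∧_) (all-false x∈ys px≡false)) (∧-zeroʳ (p y))

any-none : ∀ {p : A → Bool} {xs} → All (λ x → p x ≡ false) xs → any p xs ≡ false
any-none []         = refl
any-none (px ∷ pxs) = cong₂ _∨_ px (any-none pxs)

sum-map-cong : ∀ {g h : A → ℕ} → (∀ x → g x ≡ h x) → ∀ xs → sum (map g xs) ≡ sum (map h xs)
sum-map-cong g≗h xs = cong sum (map-cong g≗h xs)

sum-map-++ : ∀ (h : A → ℕ) xs ys → sum (map h (xs ++ ys)) ≡ sum (map h xs) + sum (map h ys)
sum-map-++ h xs ys = trans (cong sum (map-++ h xs ys)) (sum-++ (map h xs) (map h ys))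

sum-map-∘ : ∀ (h : B → ℕ) (g : A → B) xs → sum (map h (map g xs)) ≡ sum (map (h ∘ g) xs)
sum-map-∘ h g xs = cong sum (sym (map-∘ xs))

sum-map-+ : ∀ (g h : A → ℕ) xs → sum (map (λ x → g x + h x) xs) ≡ sum (map g xs) + sum (map h xs)
sum-map-+ g h []       = refl
sum-map-+ g h (x ∷ xs) =
  trans (cong (g x + h x +_) (sum-map-+ g h xs)) (interchange (g x) (h x) _ _)

sum-map-zero : ∀ (xs : List A) → sum (map (λ _ → 0) xs) ≡ 0
sum-map-zero []       = refl
sum-map-zero (x ∷ xs) = sum-map-zero xs

sum-map-concatMap : ∀ (h : A → ℕ) (g : B → List A) xs →
                    sum (map h (concatMap g xs)) ≡ sum (map (λ x → sum (map h (g x))) xs)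
sum-map-concatMap h g []       = refl
sum-map-concatMap h g (x ∷ xs) =
  trans (sum-map-++ h (g x) (concatMap g xs)) (cong (sum (map h (g x)) +_) (sum-map-concatMap h g xs))

sublists : List A → List (List A)
sublists []       = [] ∷ []
sublists (x ∷ xs) = map (x ∷_) (sublists xs) ++ sublists xs

sumSublists : List A → (List A → ℕ) → ℕ
sumSublists xs h = sum (map h (sublists xs))

sumSublists-∷ : ∀ (x : A) xs h → sumSublists (x ∷ xs) h ≡ sumSublists xs (h ∘ (x ∷_)) + sumSublists xs h
sumSublists-∷ x xs h =
  trans (sum-map-++ h (map (x ∷_) (sublists xs)) (sublists xs)) (cong (_+ _) (sum-map-∘ h (x ∷_) (sublists xs)))

sumSublists-cong : ∀ (xs : List A) {g h : List A → ℕ} → (∀ S → g S ≡ h S) → sumSublists xs g ≡ sumSublists xs h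
sumSublists-cong xs g≗h = sum-map-cong g≗h (sublists xs)

sumSublists-cong-All : ∀ {Q : A → Set} {xs} {g h : List A → ℕ} → All Q xs →
                       (∀ S → All Q S → g S ≡ h S) → sumSublists xs g ≡ sumSublists xs h
sumSublists-cong-All {xs = []}     []         g≗h = cong (_+ 0) (g≗h [] [])
sumSublists-cong-All {xs = x ∷ xs} {g} {h} (qx ∷ qxs) g≗h = begin
  sumSublists (x ∷ xs) g
    ≡⟨ sumSublists-∷ x xs g ⟩
  sumSublists xs (g ∘ (x ∷_)) + sumSublists xs g
    ≡⟨ cong₂ _+_ (sumSublists-cong-All qxs (λ S qS → g≗h (x ∷ S) (qx ∷ qS))) (sumSublists-cong-All qxs g≗h) ⟩
  sumSublists xs (h ∘ (x ∷_)) + sumSublists xs h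
    ≡⟨ sumSublists-∷ x xs h ⟨
  sumSublists (x ∷ xs) h
    ∎
  where open ≡-Reasoning

sumSublists-↭ : ∀ {xs ys : List A} (h : List A → ℕ) → (∀ {S S′} → S ↭ S′ → h S ≡ h S′) →
                xs ↭ ys → sumSublists xs h ≡ sumSublists ys h
sumSublists-↭ h resp ↭.refl = refl
sumSublists-↭ h resp (↭.trans p q) = trans (sumSublists-↭ h resp p) (sumSublists-↭ h resp q)
sumSublists-↭ {xs = x ∷ xs} {x ∷ ys} h resp (↭.prep x p) = begin
  sumSublists (x ∷ xs) h
    ≡⟨ sumSublists-∷ x xs h ⟩
  sumSublists xs (h ∘ (x ∷_)) + sumSublists xs h
    ≡⟨ cong₂ _+_ (sumSublists-↭ _ (resp ∘ ↭.prep x) p) (sumSublists-↭ h resp p) ⟩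
  sumSublists ys (h ∘ (x ∷_)) + sumSublists ys h
    ≡⟨ sumSublists-∷ x ys h ⟨
  sumSublists (x ∷ ys) h
    ∎
  where open ≡-Reasoning
sumSublists-↭ {xs = x ∷ y ∷ xs} {y ∷ x ∷ ys} h resp (↭.swap x y p) = begin
  sumSublists (x ∷ y ∷ xs) h
    ≡⟨ trans (sumSublists-∷ x (y ∷ xs) h) (cong₂ _+_ (sumSublists-∷ y xs _) (sumSublists-∷ y xs h)) ⟩
  (Σ xs (h ∘ (x ∷_) ∘ (y ∷_)) + Σ xs (h ∘ (x ∷_))) + (Σ xs (h ∘ (y ∷_)) + Σ xs h)
    ≡⟨ interchange (Σ xs (h ∘ (x ∷_) ∘ (y ∷_))) (Σ xs (h ∘ (x ∷_))) (Σ xs (h ∘ (y ∷_))) (Σ xs h) ⟩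
  (Σ xs (h ∘ (x ∷_) ∘ (y ∷_)) + Σ xs (h ∘ (y ∷_))) + (Σ xs (h ∘ (x ∷_)) + Σ xs h)
    ≡⟨ cong₂ _+_ (cong₂ _+_ swapped (sumSublists-↭ _ (resp ∘ ↭.prep y) p))
                 (cong₂ _+_ (sumSublists-↭ _ (resp ∘ ↭.prep x) p) (sumSublists-↭ h resp p)) ⟩
  (Σ ys (h ∘ (y ∷_) ∘ (x ∷_)) + Σ ys (h ∘ (y ∷_))) + (Σ ys (h ∘ (x ∷_)) + Σ ys h)
    ≡⟨ trans (sumSublists-∷ y (x ∷ ys) h) (cong₂ _+_ (sumSublists-∷ x ys _) (sumSublists-∷ x ys h)) ⟨
  sumSublists (y ∷ x ∷ ys) h
    ∎
  where
  open ≡-Reasoning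
  Σ = sumSublists
  swapped : Σ xs (h ∘ (x ∷_) ∘ (y ∷_)) ≡ Σ ys (h ∘ (y ∷_) ∘ (x ∷_))
  swapped = trans (sumSublists-cong xs (λ S → resp (↭.swap x y ↭.refl)))
                  (sumSublists-↭ _ (resp ∘ ↭.prep y ∘ ↭.prep x) p)

sumSublists-map : ∀ (g : B → A) xs (h : List A → ℕ) → sumSublists (map g xs) h ≡ sumSublists xs (h ∘ map g)
sumSublists-map g []       h = refl
sumSublists-map g (x ∷ xs) h = begin
  sumSublists (g x ∷ map g xs) h
    ≡⟨ sumSublists-∷ (g x) (map g xs) h ⟩
  sumSublists (map g xs) (h ∘ (g x ∷_)) + sumSublists (map g xs) h
    ≡⟨ cong₂ _+_ (sumSublists-map g xs _) (sumSublists-map g xs h) ⟩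
  sumSublists xs (h ∘ map g ∘ (x ∷_)) + sumSublists xs (h ∘ map g)
    ≡⟨ sumSublists-∷ x xs (h ∘ map g) ⟨
  sumSublists (x ∷ xs) (h ∘ map g)
    ∎
  where open ≡-Reasoning

sumSublists-+ : ∀ (xs : List A) (g h : List A → ℕ) →
                sumSublists xs (λ S → g S + h S) ≡ sumSublists xs g + sumSublists xs h
sumSublists-+ xs g h = sum-map-+ g h (sublists xs)

sumSublists²-zero : ∀ (xs : List A) (ys : List B) → sumSublists xs (λ _ → sumSublists ys (λ _ → 0)) ≡ 0
sumSublists²-zero xs ys =
  trans (sumSublists-cong xs (λ _ → sum-map-zero (sublists ys))) (sum-map-zero (sublists xs))

sum-allSel-select : ∀ (xs : List A) (h : List A → ℕ) →
                    sum (map (h ∘ select xs) (allSel (length xs))) ≡ sumSublists xs h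
sum-allSel-select []       h = refl
sum-allSel-select (x ∷ xs) h = begin
  sum (map (h ∘ select (x ∷ xs)) (map (true Vec.∷_) sels ++ map (false Vec.∷_) sels))
    ≡⟨ sum-map-++ _ (map (true Vec.∷_) sels) _ ⟩
  sum (map (h ∘ select (x ∷ xs)) (map (true Vec.∷_) sels)) + sum (map (h ∘ select (x ∷ xs)) (map (false Vec.∷_) sels))
    ≡⟨ cong₂ _+_ (trans (sum-map-∘ _ (true Vec.∷_) sels) (sum-allSel-select xs _))
                 (trans (sum-map-∘ _ (false Vec.∷_) sels) (sum-allSel-select xs h)) ⟩
  sumSublists xs (h ∘ (x ∷_)) + sumSublists xs h
    ≡⟨ sumSublists-∷ x xs h ⟨
  sumSublists (x ∷ xs) h
    ∎
  where
  open ≡-Reasoning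
  sels = allSel (length xs)

-- Partial tilings

_≟ᵛ_ : (u v : Vertex) → Dec (u ≡ v)
_≟ᵛ_ = ≡-dec ℕ._≟_ ℤ._≟_

=ᵛ-true : ∀ {u v} → u ≡ v → (u =ᵛ v) ≡ true
=ᵛ-true {u} {v} u≡v = trans (isYes≗does (u ≟ᵛ v)) (dec-true (u ≟ᵛ v) u≡v)

=ᵛ-refl : ∀ u → (u =ᵛ u) ≡ true
=ᵛ-refl u = =ᵛ-true {u} refl

=ᵛ-false : ∀ {u v} → u ≢ v → (u =ᵛ v) ≡ false
=ᵛ-false {u} {v} u≢v = trans (isYes≗does (u ≟ᵛ v)) (dec-false (u ≟ᵛ v) u≢v)

=ᵛ-injective : ∀ {φ : Vertex → Vertex} → Injective _≡_ _≡_ φ → ∀ u v → (φ u =ᵛ φ v) ≡ (u =ᵛ v)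
=ᵛ-injective {φ} φ-inj u v = by-cases (u ≟ᵛ v)
  where
  by-cases : Dec (u ≡ v) → (φ u =ᵛ φ v) ≡ (u =ᵛ v)
  by-cases (yes u≡v) = trans (=ᵛ-true (cong φ u≡v)) (sym (=ᵛ-true u≡v))
  by-cases (no  u≢v) = trans (=ᵛ-false (u≢v ∘ φ-inj)) (sym (=ᵛ-false u≢v))

Edge : Set
Edge = Vertex × Vertex

Cell : Set
Cell = List Vertex

-- Cover v is the number of already chosen blocks containing v.
Cover : Set
Cover = Vertex → ℕ

uncovered : Cover
uncovered _ = 0

_+edge_ : Cover → Edge → Cover
(pre +edge e) v = pre v + toℕ (inEdge v e)

_+cell_ : Cover → Cell → Cover
(pre +cell c) v = pre v + toℕ (inCycle v c)

pairCover : Vertex → Vertex → Cover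
pairCover a b v = toℕ (v =ᵛ a) + toℕ (v =ᵛ b)

pairCover-disjoint : ∀ {a b} → a ≢ b → ∀ v → toℕ ((v =ᵛ a) ∨ (v =ᵛ b)) ≡ pairCover a b v
pairCover-disjoint {a} {b} a≢b v = by-cases (v ≟ᵛ a)
  where
  by-cases : Dec (v ≡ a) → toℕ ((v =ᵛ a) ∨ (v =ᵛ b)) ≡ pairCover a b v
  by-cases (yes v≡a) rewrite =ᵛ-true v≡a | =ᵛ-false (a≢b ∘ trans (sym v≡a)) = refl
  by-cases (no  v≢a) rewrite =ᵛ-false v≢a = refl

covering : List Edge → List Cell → Vertex → ℕ
covering E C v = count (inEdge v) E + count (inCycle v) C

exactCover : List Vertex → Cover → List Edge → List Cell → Bool
exactCover V pre E C = all (λ v → ⌊ pre v + covering E C v ≟ 1 ⌋) V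

tilings : List Vertex → List Edge → List Cell → ℕ → Cover → ℕ
tilings V Es Cs k pre =
  sumSublists Es λ E → sumSublists Cs λ C → toℕ (exactCover V pre E C ∧ ⌊ length C ≟ k ⌋)

fWith : Cover → ℕ → PlaneGraph → ℕ
fWith pre k G = tilings (vertices G) (edges G) (cycles G) k pre

atPred : (ℕ → ℕ) → ℕ → ℕ
atPred g zero    = 0
atPred g (suc k) = g k

atPred-cong : ∀ {g h : ℕ → ℕ} → (∀ j → g j ≡ h j) → ∀ k → atPred g k ≡ atPred h k
atPred-cong g≗h zero    = refl
atPred-cong g≗h (suc k) = g≗h k

atPred-zero : ∀ {g : ℕ → ℕ} → (∀ j → g j ≡ 0) → ∀ k → atPred g k ≡ 0
atPred-zero g≗0 zero    = refl
atPred-zero g≗0 (suc k) = g≗0 k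

fPred≡atPred : ∀ k G → fPred k G ≡ atPred (λ j → f j G) k
fPred≡atPred zero    G = refl
fPred≡atPred (suc k) G = refl

f≡fWith-uncovered : ∀ k G → f k G ≡ fWith uncovered k G
f≡fWith-uncovered k G = begin
  f k G
    ≡⟨ count≡sum _ (allChoices G) ⟩
  sum (map (toℕ ∘ faceOfDim) (concatMap (λ se → map (se ,_) (allSel (length Cs))) (allSel (length Es))))
    ≡⟨ sum-map-concatMap _ _ (allSel (length Es)) ⟩
  sum (map (λ se → sum (map (toℕ ∘ faceOfDim) (map (se ,_) (allSel (length Cs))))) (allSel (length Es)))
    ≡⟨ sum-map-cong (λ se → trans (sum-map-∘ _ (se ,_) (allSel (length Cs)))
                                  (sum-allSel-select Cs (weight (select Es se)))) (allSel (length Es)) ⟩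
  sum (map (λ se → sumSublists Cs (weight (select Es se))) (allSel (length Es)))
    ≡⟨ sum-allSel-select Es (λ E → sumSublists Cs (weight E)) ⟩
  fWith uncovered k G
    ∎
  where
  open ≡-Reasoning
  Es = edges G
  Cs = cycles G
  faceOfDim : Choice G → Bool
  faceOfDim c = isTiling G c ∧ ⌊ dim G c ≟ k ⌋
  weight : List Edge → List Cell → ℕ
  weight E C = toℕ (exactCover (vertices G) uncovered E C ∧ ⌊ length C ≟ k ⌋)

exactCover-edge∷ : ∀ V pre e E C → exactCover V pre (e ∷ E) C ≡ exactCover V (pre +edge e) E C
exactCover-edge∷ V pre e E C = cong and (map-cong (λ v → cong (λ n → ⌊ n ≟ 1 ⌋) (begin
  pre v + (count (inEdge v) (e ∷ E) + count (inCycle v) C)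
    ≡⟨ cong (λ n → pre v + (n + count (inCycle v) C)) (count-∷ (inEdge v) e E) ⟩
  pre v + (toℕ (inEdge v e) + count (inEdge v) E + count (inCycle v) C)
    ≡⟨ reassoc (pre v) (toℕ (inEdge v e)) (count (inEdge v) E) (count (inCycle v) C) ⟩
  pre v + toℕ (inEdge v e) + covering E C v
    ∎)) V)
  where
  open ≡-Reasoning
  reassoc : ∀ a i b c → a + (i + b + c) ≡ a + i + (b + c)
  reassoc = solve-∀

exactCover-cell∷ : ∀ V pre c E C → exactCover V pre E (c ∷ C) ≡ exactCover V (pre +cell c) E C
exactCover-cell∷ V pre c E C = cong and (map-cong (λ v → cong (λ n → ⌊ n ≟ 1 ⌋) (begin
  pre v + (count (inEdge v) E + count (inCycle v) (c ∷ C))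
    ≡⟨ cong (λ n → pre v + (count (inEdge v) E + n)) (count-∷ (inCycle v) c C) ⟩
  pre v + (count (inEdge v) E + (toℕ (inCycle v c) + count (inCycle v) C))
    ≡⟨ reassoc (pre v) (count (inEdge v) E) (toℕ (inCycle v c)) (count (inCycle v) C) ⟩
  pre v + toℕ (inCycle v c) + covering E C v
    ∎)) V)
  where
  open ≡-Reasoning
  reassoc : ∀ a b i c → a + (b + (i + c)) ≡ a + i + (b + c)
  reassoc = solve-∀

tilings-edge∷ : ∀ V e Es Cs k pre →
                tilings V (e ∷ Es) Cs k pre ≡ tilings V Es Cs k (pre +edge e) + tilings V Es Cs k pre
tilings-edge∷ V e Es Cs k pre = trans (sumSublists-∷ e Es _) (cong (_+ _)
  (sumSublists-cong Es λ E → sumSublists-cong Cs λ C →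
    cong (λ b → toℕ (b ∧ ⌊ length C ≟ k ⌋)) (exactCover-edge∷ V pre e E C)))

tilings-cell∷ : ∀ V Es c Cs k pre →
                tilings V Es (c ∷ Cs) k pre ≡ atPred (λ j → tilings V Es Cs j (pre +cell c)) k + tilings V Es Cs k pre
tilings-cell∷ V Es c Cs k pre =
  trans (sumSublists-cong Es (λ E → sumSublists-∷ c Cs _)) (trans (sumSublists-+ Es _ _) (cong (_+ _) (with-c k)))
  where
  with-c : ∀ k → sumSublists Es (λ E → sumSublists Cs λ C → toℕ (exactCover V pre E (c ∷ C) ∧ ⌊ suc (length C) ≟ k ⌋))
                 ≡ atPred (λ j → tilings V Es Cs j (pre +cell c)) k
  with-c zero    = trans (sumSublists-cong Es λ E → sumSublists-cong Cs λ C → cong toℕ (∧-zeroʳ _))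
                         (sumSublists²-zero Es Cs)
  with-c (suc k) = sumSublists-cong Es λ E → sumSublists-cong Cs λ C →
    cong₂ (λ b d → toℕ (b ∧ d)) (exactCover-cell∷ V pre c E C) (⌊suc≟suc⌋ (length C) k)

tilings-overcovered : ∀ {v} V Es Cs k pre → v ∈ V → pre v ≡ 2 → tilings V Es Cs k pre ≡ 0
tilings-overcovered {v} V Es Cs k pre v∈V pre-v≡2 = trans
  (sumSublists-cong Es λ E → sumSublists-cong Cs λ C → cong (λ b → toℕ (b ∧ ⌊ length C ≟ k ⌋))
    (all-false v∈V (cong (λ n → ⌊ n + covering E C v ≟ 1 ⌋) pre-v≡2)))
  (sumSublists²-zero Es Cs)

tilings-skip-edge : ∀ {v} V e Es Cs k pre → v ∈ V → pre v ≡ 1 → inEdge v e ≡ true →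
                    tilings V (e ∷ Es) Cs k pre ≡ tilings V Es Cs k pre
tilings-skip-edge V e Es Cs k pre v∈V pre-v≡1 v∈e = trans (tilings-edge∷ V e Es Cs k pre)
  (cong (_+ _) (tilings-overcovered V Es Cs k (pre +edge e) v∈V (cong₂ (λ n b → n + toℕ b) pre-v≡1 v∈e)))

tilings-skip-cell : ∀ {v} V Es c Cs k pre → v ∈ V → pre v ≡ 1 → inCycle v c ≡ true →
                    tilings V Es (c ∷ Cs) k pre ≡ tilings V Es Cs k pre
tilings-skip-cell V Es c Cs k pre v∈V pre-v≡1 v∈c = trans (tilings-cell∷ V Es c Cs k pre)
  (cong (_+ _) (atPred-zero (λ j → tilings-overcovered V Es Cs j (pre +cell c) v∈V
                                     (cong₂ (λ n b → n + toℕ b) pre-v≡1 v∈c)) k))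

Untouched : Vertex → List Edge → List Cell → Set
Untouched v Es Cs = All (λ e → inEdge v e ≡ false) Es × All (λ c → inCycle v c ≡ false) Cs

tilings-untouched : ∀ {p} V Es Cs k pre → Untouched p Es Cs →
                    tilings (p ∷ V) Es Cs k pre ≡ (if ⌊ pre p ≟ 1 ⌋ then tilings V Es Cs k pre else 0)
tilings-untouched {p} V Es Cs k pre (p∉Es , p∉Cs) = trans
  (sumSublists-cong-All p∉Es λ E p∉E → sumSublists-cong-All p∉Cs λ C p∉C →
    cong (λ n → toℕ ((⌊ n ≟ 1 ⌋ ∧ exactCover V pre E C) ∧ ⌊ length C ≟ k ⌋))
      (trans (cong (pre p +_) (cong₂ _+_ (count-none p∉E) (count-none p∉C))) (+-identityʳ (pre p))))
  (by-cases ⌊ pre p ≟ 1 ⌋)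
  where
  by-cases : ∀ b → sumSublists Es (λ E → sumSublists Cs λ C → toℕ ((b ∧ exactCover V pre E C) ∧ ⌊ length C ≟ k ⌋))
                   ≡ (if b then tilings V Es Cs k pre else 0)
  by-cases true  = refl
  by-cases false = sumSublists²-zero Es Cs

tilings-drop-covered : ∀ {p} V Es Cs k pre → Untouched p Es Cs → pre p ≡ 1 →
                       tilings (p ∷ V) Es Cs k pre ≡ tilings V Es Cs k pre
tilings-drop-covered V Es Cs k pre p-untouched pre-p≡1 = trans (tilings-untouched V Es Cs k pre p-untouched)
  (cong (λ n → if ⌊ n ≟ 1 ⌋ then tilings V Es Cs k pre else 0) pre-p≡1)

tilings-uncoverable : ∀ {p} V Es Cs k pre → Untouched p Es Cs → pre p ≡ 0 → tilings (p ∷ V) Es Cs k pre ≡ 0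
tilings-uncoverable V Es Cs k pre p-untouched pre-p≡0 = trans (tilings-untouched V Es Cs k pre p-untouched)
  (cong (λ n → if ⌊ n ≟ 1 ⌋ then tilings V Es Cs k pre else 0) pre-p≡0)

tilings-cover-cong : ∀ V Es Cs k {pre pre′} → All (λ v → pre v ≡ pre′ v) V →
                     tilings V Es Cs k pre ≡ tilings V Es Cs k pre′
tilings-cover-cong V Es Cs k pre≗pre′ = sumSublists-cong Es λ E → sumSublists-cong Cs λ C →
  cong (λ b → toℕ (b ∧ ⌊ length C ≟ k ⌋))
    (cong and (map-cong-local (All.map (λ {v} → cong (λ n → ⌊ n + covering E C v ≟ 1 ⌋)) pre≗pre′)))

exactCover-↭ : ∀ {V V′ E E′ C C′} pre → V ↭ V′ → E ↭ E′ → C ↭ C′ → exactCover V pre E C ≡ exactCover V′ pre E′ C′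
exactCover-↭ {V′ = V′} pre V↭V′ E↭E′ C↭C′ = trans (all-↭ _ V↭V′) (cong and (map-cong (λ v →
  cong (λ n → ⌊ pre v + n ≟ 1 ⌋) (cong₂ _+_ (count-↭ (inEdge v) E↭E′) (count-↭ (inCycle v) C↭C′))) V′))

tilings-↭ : ∀ {V V′ Es Es′ Cs Cs′} k pre → V ↭ V′ → Es ↭ Es′ → Cs ↭ Cs′ →
            tilings V Es Cs k pre ≡ tilings V′ Es′ Cs′ k pre
tilings-↭ {V} {V′} {Es} {Es′} {Cs} {Cs′} k pre V↭V′ Es↭Es′ Cs↭Cs′ = begin
  tilings V Es Cs k pre
    ≡⟨ (sumSublists-cong Es λ E → sumSublists-cong Cs λ C →
         cong (λ b → toℕ (b ∧ ⌊ length C ≟ k ⌋)) (exactCover-↭ {E = E} {C = C} pre V↭V′ ↭.refl ↭.refl)) ⟩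
  tilings V′ Es Cs k pre
    ≡⟨ sumSublists-↭ _ (λ E↭E′ → sumSublists-cong Cs λ C →
         cong (λ b → toℕ (b ∧ ⌊ length C ≟ k ⌋)) (exactCover-↭ {V = V′} {C = C} pre ↭.refl E↭E′ ↭.refl)) Es↭Es′ ⟩
  tilings V′ Es′ Cs k pre
    ≡⟨ (sumSublists-cong Es′ λ E → sumSublists-↭ _ (λ C↭C′ →
         cong₂ (λ b l → toℕ (b ∧ ⌊ l ≟ k ⌋))
               (exactCover-↭ {V = V′} {E = E} pre ↭.refl ↭.refl C↭C′) (↭-length C↭C′)) Cs↭Cs′) ⟩
  tilings V′ Es′ Cs′ k pre
    ∎
  where open ≡-Reasoning

module _ {φ : Vertex → Vertex} (φ-injective : Injective _≡_ _≡_ φ) where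

  covering-rename : ∀ E C v → covering (map (×.map φ φ) E) (map (map φ) C) (φ v) ≡ covering E C v
  covering-rename E C v = cong₂ _+_
    (count-map _ (λ (u , w) → cong₂ _∨_ (=ᵛ-injective φ-injective v u) (=ᵛ-injective φ-injective v w)) E)
    (count-map _ (λ c → trans (cong or (sym (map-∘ c))) (cong or (map-cong (=ᵛ-injective φ-injective v) c))) C)

  tilings-rename : ∀ V Es Cs k pre →
                   tilings (map φ V) (map (×.map φ φ) Es) (map (map φ) Cs) k pre ≡ tilings V Es Cs k (pre ∘ φ)
  tilings-rename V Es Cs k pre =
    trans (sumSublists-map _ Es _) (sumSublists-cong Es λ E → trans (sumSublists-map (map φ) Cs _)
      (sumSublists-cong Cs λ C → cong₂ (λ b l → toℕ (b ∧ ⌊ l ≟ k ⌋))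
        (trans (cong and (sym (map-∘ V)))
               (cong and (map-cong (λ v → cong (λ n → ⌊ pre (φ v) + n ≟ 1 ⌋) (covering-rename E C v)) V)))
        (length-map (map φ) C)))

-- Adding a column at the end of a graph

Inside : (Vertex → Set) → PlaneGraph → Set
Inside R G = All R (vertices G) × All (λ e → R (proj₁ e) × R (proj₂ e)) (edges G) × All (All R) (cycles G)

Inside⇒Untouched : ∀ {R : Vertex → Set} {p} G → (∀ {v} → R v → v ≢ p) → Inside R G → Untouched p (edges G) (cycles G)
Inside⇒Untouched G p∉R (_ , Es⊆R , Cs⊆R) =
    All.map (λ (u∈R , w∈R) → cong₂ _∨_ (=ᵛ-false (≢-sym (p∉R u∈R))) (=ᵛ-false (≢-sym (p∉R w∈R)))) Es⊆R
  , All.map (λ c⊆R → any-none (All.map (λ v∈R → =ᵛ-false (≢-sym (p∉R v∈R))) c⊆R)) Cs⊆R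

module AddColumn
  (G : PlaneGraph) (R : Vertex → Set) (G⊆R : Inside R G)
  (p q a b : Vertex) (pq pa qb : Edge) (c : Cell)
  (p∉R : ∀ {v} → R v → v ≢ p) (q∉R : ∀ {v} → R v → v ≢ q)
  (p≢q : p ≢ q) (p≢b : p ≢ b) (q≢a : q ≢ a) (a≢b : a ≢ b)
  (pq-ends : ∀ v → inEdge v pq ≡ (v =ᵛ p) ∨ (v =ᵛ q))
  (pa-ends : ∀ v → inEdge v pa ≡ (v =ᵛ p) ∨ (v =ᵛ a))
  (qb-ends : ∀ v → inEdge v qb ≡ (v =ᵛ q) ∨ (v =ᵛ b))
  (c-corners : ∀ v → inCycle v c ≡ ((v =ᵛ p) ∨ (v =ᵛ q)) ∨ ((v =ᵛ a) ∨ (v =ᵛ b)))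
  where

  extended : PlaneGraph
  extended = record
    { vertices = p ∷ q ∷ vertices G
    ; edges    = pa ∷ qb ∷ pq ∷ edges G
    ; cycles   = c ∷ cycles G
    }

  private
    V  = vertices G
    Es = edges G
    Cs = cycles G
    W  = vertices extended

    p∈W : p ∈ W
    p∈W = here refl

    q∈W : q ∈ W
    q∈W = there (here refl)

    p-untouched : Untouched p Es Cs
    p-untouched = Inside⇒Untouched G p∉R G⊆R

    q-untouched : Untouched q Es Cs
    q-untouched = Inside⇒Untouched G q∉R G⊆R

    p∈pq : inEdge p pq ≡ true
    p∈pq = trans (pq-ends p) (cong (_∨ (p =ᵛ q)) (=ᵛ-refl p))

    q∈pq : inEdge q pq ≡ true
    q∈pq = trans (pq-ends q) (cong₂ _∨_ (=ᵛ-false (≢-sym p≢q)) (=ᵛ-refl q))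

    p∈pa : inEdge p pa ≡ true
    p∈pa = trans (pa-ends p) (cong (_∨ (p =ᵛ a)) (=ᵛ-refl p))

    q∉pa : inEdge q pa ≡ false
    q∉pa = trans (pa-ends q) (cong₂ _∨_ (=ᵛ-false (≢-sym p≢q)) (=ᵛ-false q≢a))

    p∉qb : inEdge p qb ≡ false
    p∉qb = trans (qb-ends p) (cong₂ _∨_ (=ᵛ-false p≢q) (=ᵛ-false p≢b))

    q∈qb : inEdge q qb ≡ true
    q∈qb = trans (qb-ends q) (cong (_∨ (q =ᵛ b)) (=ᵛ-refl q))

    p∈c : inCycle p c ≡ true
    p∈c = trans (c-corners p) (cong (λ x → (x ∨ (p =ᵛ q)) ∨ ((p =ᵛ a) ∨ (p =ᵛ b))) (=ᵛ-refl p))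

    q∈c : inCycle q c ≡ true
    q∈c = trans (c-corners q) (cong₂ (λ x y → (x ∨ y) ∨ ((q =ᵛ a) ∨ (q =ᵛ b))) (=ᵛ-false (≢-sym p≢q)) (=ᵛ-refl q))

    agree-on-V : ∀ {pre pre′ : Cover} → (∀ {v} → v ≢ p → v ≢ q → pre v ≡ pre′ v) → All (λ v → pre v ≡ pre′ v) V
    agree-on-V pre≗pre′ = All.map (λ v∈R → pre≗pre′ (p∉R v∈R) (q∉R v∈R)) (proj₁ G⊆R)

    pq-on-V : ∀ {v} → v ≢ p → v ≢ q → toℕ (inEdge v pq) ≡ 0
    pq-on-V {v} v≢p v≢q = cong toℕ (trans (pq-ends v) (cong₂ _∨_ (=ᵛ-false v≢p) (=ᵛ-false v≢q)))

    rails-on-V : ∀ {v} → v ≢ p → v ≢ q → toℕ (inEdge v pa) + toℕ (inEdge v qb) ≡ pairCover a b v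
    rails-on-V {v} v≢p v≢q = cong₂ (λ x y → toℕ x + toℕ y)
      (trans (pa-ends v) (cong (_∨ (v =ᵛ a)) (=ᵛ-false v≢p)))
      (trans (qb-ends v) (cong (_∨ (v =ᵛ b)) (=ᵛ-false v≢q)))

    c-on-V : ∀ {v} → v ≢ p → v ≢ q → toℕ (inCycle v c) ≡ pairCover a b v
    c-on-V {v} v≢p v≢q = trans
      (cong toℕ (trans (c-corners v) (cong₂ (λ x y → (x ∨ y) ∨ ((v =ᵛ a) ∨ (v =ᵛ b))) (=ᵛ-false v≢p) (=ᵛ-false v≢q))))
      (pairCover-disjoint a≢b v)

    close-p : ∀ k pre → pre p ≡ 1 → tilings W (pq ∷ Es) (c ∷ Cs) k pre ≡ tilings W Es Cs k pre
    close-p k pre pre-p≡1 = trans (tilings-skip-edge W pq Es (c ∷ Cs) k pre p∈W pre-p≡1 p∈pq)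
                               (tilings-skip-cell W Es c Cs k pre p∈W pre-p≡1 p∈c)

    close-q : ∀ k pre → pre q ≡ 1 → tilings W (pq ∷ Es) (c ∷ Cs) k pre ≡ tilings W Es Cs k pre
    close-q k pre pre-q≡1 = trans (tilings-skip-edge W pq Es (c ∷ Cs) k pre q∈W pre-q≡1 q∈pq)
                               (tilings-skip-cell W Es c Cs k pre q∈W pre-q≡1 q∈c)

    drop-column : ∀ k pre pre′ → pre p ≡ 1 → pre q ≡ 1 → (∀ {v} → v ≢ p → v ≢ q → pre v ≡ pre′ v) →
                  tilings W Es Cs k pre ≡ tilings V Es Cs k pre′
    drop-column k pre pre′ pre-p≡1 pre-q≡1 pre≗pre′ = begin
      tilings W Es Cs k pre        ≡⟨ tilings-drop-covered (q ∷ V) Es Cs k pre p-untouched pre-p≡1 ⟩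
      tilings (q ∷ V) Es Cs k pre  ≡⟨ tilings-drop-covered V Es Cs k pre q-untouched pre-q≡1 ⟩
      tilings V Es Cs k pre        ≡⟨ tilings-cover-cong V Es Cs k (agree-on-V pre≗pre′) ⟩
      tilings V Es Cs k pre′       ∎
      where open ≡-Reasoning

  f-extended : ∀ k → fWith uncovered k extended
                   ≡ fWith uncovered k G + fWith (pairCover a b) k G + atPred (λ j → fWith (pairCover a b) j G) k
  f-extended k = begin
    tilings W (pa ∷ qb ∷ pq ∷ Es) (c ∷ Cs) k uncovered
      ≡⟨ tilings-edge∷ W pa (qb ∷ pq ∷ Es) (c ∷ Cs) k uncovered ⟩
    tilings W (qb ∷ pq ∷ Es) (c ∷ Cs) k by-pa + tilings W (qb ∷ pq ∷ Es) (c ∷ Cs) k uncovered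
      ≡⟨ cong₂ _+_ with-pa without-pa ⟩
    tilings V Es Cs k (pairCover a b) + (tilings V Es Cs k uncovered + atPred ab-covered k)
      ≡⟨ x∙yz≈yx∙z (tilings V Es Cs k (pairCover a b)) (tilings V Es Cs k uncovered) (atPred ab-covered k) ⟩
    tilings V Es Cs k uncovered + tilings V Es Cs k (pairCover a b) + atPred ab-covered k
      ∎
    where
    open ≡-Reasoning

    ab-covered : ℕ → ℕ
    ab-covered j = tilings V Es Cs j (pairCover a b)

    by-pa by-qb by-rails : Cover
    by-pa    = uncovered +edge pa
    by-qb    = uncovered +edge qb
    by-rails = by-pa +edge qb

    with-pa : tilings W (qb ∷ pq ∷ Es) (c ∷ Cs) k by-pa ≡ tilings V Es Cs k (pairCover a b)
    with-pa = begin
      tilings W (qb ∷ pq ∷ Es) (c ∷ Cs) k by-pa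
        ≡⟨ tilings-edge∷ W qb (pq ∷ Es) (c ∷ Cs) k by-pa ⟩
      tilings W (pq ∷ Es) (c ∷ Cs) k by-rails + tilings W (pq ∷ Es) (c ∷ Cs) k by-pa
        ≡⟨ cong₂ _+_ both-rails pa-alone ⟩
      tilings V Es Cs k (pairCover a b) + 0
        ≡⟨ +-identityʳ _ ⟩
      tilings V Es Cs k (pairCover a b)
        ∎
      where
      p-by-rails : by-rails p ≡ 1
      p-by-rails = cong₂ (λ x y → toℕ x + toℕ y) p∈pa p∉qb

      q-by-rails : by-rails q ≡ 1
      q-by-rails = cong₂ (λ x y → toℕ x + toℕ y) q∉pa q∈qb

      both-rails : tilings W (pq ∷ Es) (c ∷ Cs) k by-rails ≡ tilings V Es Cs k (pairCover a b)
      both-rails = trans (close-p k by-rails p-by-rails)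
                         (drop-column k by-rails (pairCover a b) p-by-rails q-by-rails rails-on-V)

      pa-alone : tilings W (pq ∷ Es) (c ∷ Cs) k by-pa ≡ 0
      pa-alone = begin
        tilings W (pq ∷ Es) (c ∷ Cs) k by-pa
          ≡⟨ close-p k by-pa (cong toℕ p∈pa) ⟩
        tilings W Es Cs k by-pa
          ≡⟨ tilings-drop-covered (q ∷ V) Es Cs k by-pa p-untouched (cong toℕ p∈pa) ⟩
        tilings (q ∷ V) Es Cs k by-pa
          ≡⟨ tilings-uncoverable V Es Cs k by-pa q-untouched (cong toℕ q∉pa) ⟩
        0 ∎

    without-pa : tilings W (qb ∷ pq ∷ Es) (c ∷ Cs) k uncovered
                 ≡ tilings V Es Cs k uncovered + atPred ab-covered k
    without-pa = begin
      tilings W (qb ∷ pq ∷ Es) (c ∷ Cs) k uncovered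
        ≡⟨ tilings-edge∷ W qb (pq ∷ Es) (c ∷ Cs) k uncovered ⟩
      tilings W (pq ∷ Es) (c ∷ Cs) k by-qb + tilings W (pq ∷ Es) (c ∷ Cs) k uncovered
        ≡⟨ cong (_+ tilings W (pq ∷ Es) (c ∷ Cs) k uncovered) qb-alone ⟩
      tilings W (pq ∷ Es) (c ∷ Cs) k uncovered
        ≡⟨ tilings-edge∷ W pq Es (c ∷ Cs) k uncovered ⟩
      tilings W Es (c ∷ Cs) k by-pq + tilings W Es (c ∷ Cs) k uncovered
        ≡⟨ cong₂ _+_ rung (tilings-cell∷ W Es c Cs k uncovered) ⟩
      tilings V Es Cs k uncovered + (atPred (λ j → tilings W Es Cs j by-c) k + tilings W Es Cs k uncovered)
        ≡⟨ cong (tilings V Es Cs k uncovered +_) (cong₂ _+_ (atPred-cong end-square k) no-block) ⟩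
      tilings V Es Cs k uncovered + (atPred ab-covered k + 0)
        ≡⟨ cong (tilings V Es Cs k uncovered +_) (+-identityʳ _) ⟩
      tilings V Es Cs k uncovered + atPred ab-covered k
        ∎
      where
      by-pq by-c : Cover
      by-pq = uncovered +edge pq
      by-c  = uncovered +cell c

      qb-alone : tilings W (pq ∷ Es) (c ∷ Cs) k by-qb ≡ 0
      qb-alone = trans (close-q k by-qb (cong toℕ q∈qb))
                       (tilings-uncoverable (q ∷ V) Es Cs k by-qb p-untouched (cong toℕ p∉qb))

      rung : tilings W Es (c ∷ Cs) k by-pq ≡ tilings V Es Cs k uncovered
      rung = trans (tilings-skip-cell W Es c Cs k by-pq p∈W (cong toℕ p∈pq) p∈c)
                   (drop-column k by-pq uncovered (cong toℕ p∈pq) (cong toℕ q∈pq) pq-on-V)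

      end-square : ∀ j → tilings W Es Cs j by-c ≡ tilings V Es Cs j (pairCover a b)
      end-square j = drop-column j by-c (pairCover a b) (cong toℕ p∈c) (cong toℕ q∈c) c-on-V

      no-block : tilings W Es Cs k uncovered ≡ 0
      no-block = tilings-uncoverable (q ∷ V) Es Cs k uncovered p-untouched refl

  f-extended-covered : ∀ k → fWith (pairCover p q) k extended ≡ fWith uncovered k G
  f-extended-covered k = begin
    tilings W (pa ∷ qb ∷ pq ∷ Es) (c ∷ Cs) k (pairCover p q)
      ≡⟨ tilings-skip-edge W pa (qb ∷ pq ∷ Es) (c ∷ Cs) k (pairCover p q) p∈W p-covered p∈pa ⟩
    tilings W (qb ∷ pq ∷ Es) (c ∷ Cs) k (pairCover p q)
      ≡⟨ tilings-skip-edge W qb (pq ∷ Es) (c ∷ Cs) k (pairCover p q) q∈W q-covered q∈qb ⟩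
    tilings W (pq ∷ Es) (c ∷ Cs) k (pairCover p q)
      ≡⟨ close-p k (pairCover p q) p-covered ⟩
    tilings W Es Cs k (pairCover p q)
      ≡⟨ drop-column k (pairCover p q) uncovered p-covered q-covered
           (λ v≢p v≢q → cong₂ (λ x y → toℕ x + toℕ y) (=ᵛ-false v≢p) (=ᵛ-false v≢q)) ⟩
    tilings V Es Cs k uncovered
      ∎
    where
    open ≡-Reasoning
    p-covered : pairCover p q p ≡ 1
    p-covered = cong₂ (λ x y → toℕ x + toℕ y) (=ᵛ-refl p) (=ᵛ-false p≢q)
    q-covered : pairCover p q q ≡ 1
    q-covered = cong₂ (λ x y → toℕ x + toℕ y) (=ᵛ-false (≢-sym p≢q)) (=ᵛ-refl q)

infix 4 _↭ᴳ_

_↭ᴳ_ : PlaneGraph → PlaneGraph → Set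
G ↭ᴳ H = (vertices G ↭ vertices H) × (edges G ↭ edges H) × (cycles G ↭ cycles H)

fWith-↭ᴳ : ∀ pre k {G H} → G ↭ᴳ H → fWith pre k G ≡ fWith pre k H
fWith-↭ᴳ pre k (V↭ , E↭ , C↭) = tilings-↭ k pre V↭ E↭ C↭

recurrence : ∀ big mid small cov →
             (∀ k → f k big ≡ f k mid + fWith cov k mid + atPred (λ j → fWith cov j mid) k) →
             (∀ k → fWith cov k mid ≡ f k small) →
             ∀ k → f k big ≡ f k mid + f k small + fPred k small
recurrence big mid small cov peel-end peel-covered-end k = begin
  f k big
    ≡⟨ peel-end k ⟩
  f k mid + fWith cov k mid + atPred (λ j → fWith cov j mid) k
    ≡⟨ cong₂ (λ x y → f k mid + x + y) (peel-covered-end k) (atPred-cong peel-covered-end k) ⟩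
  f k mid + f k small + atPred (λ j → f j small) k
    ≡⟨ cong (f k mid + f k small +_) (fPred≡atPred k small) ⟨
  f k mid + f k small + fPred k small
    ∎
  where open ≡-Reasoning

-- Ladders

open import Data.Integer using (+_; -[1+_])

infixl 6 _∪_

_∪_ : PlaneGraph → PlaneGraph → PlaneGraph
G ∪ H = record
  { vertices = vertices G ++ vertices H
  ; edges    = edges G ++ edges H
  ; cycles   = cycles G ++ cycles H
  }

emptyGraph : PlaneGraph
emptyGraph = record { vertices = [] ; edges = [] ; cycles = [] }

∪-emptyGraph : ∀ G → G ∪ emptyGraph ≡ G
∪-emptyGraph G = fields-≡ (++-identityʳ (vertices G)) (++-identityʳ (edges G)) (++-identityʳ (cycles G))
  where
  fields-≡ : ∀ {V E C} → V ≡ vertices G → E ≡ edges G → C ≡ cycles G →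
             record { vertices = V ; edges = E ; cycles = C } ≡ G
  fields-≡ refl refl refl = refl

-- ladderSq n i is ladder n ∪ lowerSquare i, and shiftGraph (lowerSquare (suc i)) is lowerSquare (2 + i),
-- by definition.
lowerSquare : ℕ → PlaneGraph
lowerSquare i = record
  { vertices = (i ∸ 1 , -[1+ 0 ]) ∷ (i , -[1+ 0 ]) ∷ []
  ; edges    = ((i ∸ 1 , + 0) , (i ∸ 1 , -[1+ 0 ])) ∷ ((i ∸ 1 , -[1+ 0 ]) , (i , -[1+ 0 ]))
               ∷ ((i , -[1+ 0 ]) , (i , + 0)) ∷ []
  ; cycles   = ((i ∸ 1 , -[1+ 0 ]) ∷ (i , -[1+ 0 ]) ∷ (i , + 0) ∷ (i ∸ 1 , + 0) ∷ []) ∷ []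
  }

Inside-∪ : ∀ {R G H} → Inside R G → Inside R H → Inside R (G ∪ H)
Inside-∪ (VG , EG , CG) (VH , EH , CH) = ++⁺ VG VH , ++⁺ EG EH , ++⁺ CG CH

Inside-mono : ∀ {R R′ : Vertex → Set} {G} → (∀ {v} → R v → R′ v) → Inside R G → Inside R′ G
Inside-mono R⇒R′ (V⊆R , E⊆R , C⊆R) = All.map R⇒R′ V⊆R , All.map (×.map R⇒R′ R⇒R′) E⊆R , All.map (All.map R⇒R′) C⊆R

column : ℕ → List Vertex
column j = (j , + 0) ∷ (j , + 1) ∷ []

rails : ℕ → List Edge
rails j = ((j , + 0) , (suc j , + 0)) ∷ ((j , + 1) , (suc j , + 1)) ∷ []

rung : ℕ → Edge
rung j = ((j , + 0) , (j , + 1))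

square : ℕ → Cell
square j = (j , + 0) ∷ (suc j , + 0) ∷ (suc j , + 1) ∷ (j , + 1) ∷ []

columnCover : ℕ → Cover
columnCover j = pairCover (j , + 0) (j , + 1)

Within : ℕ → Vertex → Set
Within m v = proj₁ v ≤ m

ladder-within : ∀ m → Inside (Within m) (ladder m)
ladder-within m =
    concat⁺ (All-map⁺ (applyUpTo⁺₁ id (suc m) (λ j<1+m → ≤-pred j<1+m ∷ ≤-pred j<1+m ∷ [])))
  , ++⁺ (concat⁺ (All-map⁺ (applyUpTo⁺₁ id m (λ j<m → (<⇒≤ j<m , j<m) ∷ (<⇒≤ j<m , j<m) ∷ []))))
        (All-map⁺ (applyUpTo⁺₁ id (suc m) (λ j<1+m → ≤-pred j<1+m , ≤-pred j<1+m)))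
  , All-map⁺ (applyUpTo⁺₁ id m (λ j<m → <⇒≤ j<m ∷ j<m ∷ j<m ∷ <⇒≤ j<m ∷ []))

lowerSquare-within : ∀ {i m} → i ≤ m → Inside (Within m) (lowerSquare i)
lowerSquare-within {i} i≤m =
    i∸1≤m ∷ i≤m ∷ []
  , (i∸1≤m , i∸1≤m) ∷ (i∸1≤m , i≤m) ∷ (i≤m , i≤m) ∷ []
  , (i∸1≤m ∷ i≤m ∷ i≤m ∷ i∸1≤m ∷ []) ∷ []
  where
  i∸1≤m = ≤-trans (m∸n≤m i 1) i≤m

Within⇒≢-next-column : ∀ {m v} z → Within m v → v ≢ (suc m , z)
Within⇒≢-next-column z v≤m v≡ = 1+n≰n (subst (_≤ _) (cong proj₁ v≡) v≤m)

concatMap-upTo-suc : ∀ (g : ℕ → List A) n → concatMap g (upTo (suc n)) ≡ concatMap g (upTo n) ++ concatMap g [ n ]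
concatMap-upTo-suc g n = trans (cong (concatMap g) (sym (upTo-∷ʳ n))) (concatMap-++ g (upTo n) [ n ])

map-upTo-suc : ∀ (g : ℕ → A) n → map g (upTo (suc n)) ≡ map g (upTo n) ++ [ g n ]
map-upTo-suc g n = trans (cong (map g) (sym (upTo-∷ʳ n))) (map-++ g (upTo n) [ n ])

module RightEnd (m : ℕ) (X : PlaneGraph) (X≤m : Inside (Within m) X) where

  private
    p q a b : Vertex
    p = (suc m , + 0)
    q = (suc m , + 1)
    a = (m , + 0)
    b = (m , + 1)

    corners : ∀ v → inCycle v (square m) ≡ ((v =ᵛ p) ∨ (v =ᵛ q)) ∨ ((v =ᵛ a) ∨ (v =ᵛ b))
    corners v = solve 4 (λ x y z w → z :+ (x :+ (y :+ (w :+ con false))) := (x :+ y) :+ (z :+ w)) refl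
                  (v =ᵛ p) (v =ᵛ q) (v =ᵛ a) (v =ᵛ b)
      where open ∨-∧-Solver

  open AddColumn (ladder m ∪ X) (Within m) (Inside-∪ (ladder-within m) X≤m)
                 p q a b (rung (suc m)) (a , p) (b , q) (square m)
                 (Within⇒≢-next-column (+ 0)) (Within⇒≢-next-column (+ 1)) (λ ()) (λ ()) (λ ()) (λ ())
                 (λ _ → refl) (λ v → ∨-comm (v =ᵛ a) (v =ᵛ p)) (λ v → ∨-comm (v =ᵛ b) (v =ᵛ q)) corners

  private
    ladder-suc-↭ : ladder (suc m) ∪ X ↭ᴳ extended
    ladder-suc-↭ = vertices-↭ , edges-↭ , cycles-↭
      where
      open PermutationReasoning
      L  = concatMap column (upTo (suc m))
      Rs = concatMap rails (upTo m)
      Rg = map rung (upTo (suc m))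
      Sq = map square (upTo m)

      vertices-↭ : vertices (ladder (suc m)) ++ vertices X ↭ p ∷ q ∷ L ++ vertices X
      vertices-↭ = begin
        concatMap column (upTo (suc (suc m))) ++ vertices X
          ≡⟨ cong (_++ vertices X) (concatMap-upTo-suc column (suc m)) ⟩
        (L ++ column (suc m)) ++ vertices X
          ≡⟨ ++-assoc L (column (suc m)) (vertices X) ⟩
        L ++ column (suc m) ++ vertices X
          ↭⟨ shifts L (column (suc m)) ⟩
        p ∷ q ∷ L ++ vertices X
          ∎

      edges-↭ : edges (ladder (suc m)) ++ edges X ↭ (a , p) ∷ (b , q) ∷ rung (suc m) ∷ (Rs ++ Rg) ++ edges X
      edges-↭ = begin
        (concatMap rails (upTo (suc m)) ++ map rung (upTo (suc (suc m)))) ++ edges X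
          ≡⟨ cong (_++ edges X) (cong₂ _++_ (concatMap-upTo-suc rails m) (map-upTo-suc rung (suc m))) ⟩
        ((Rs ++ rails m) ++ (Rg ++ [ rung (suc m) ])) ++ edges X
          ≡⟨ trans (++-assoc (Rs ++ rails m) _ (edges X)) (++-assoc Rs (rails m) _) ⟩
        Rs ++ rails m ++ (Rg ++ [ rung (suc m) ]) ++ edges X
          ↭⟨ shifts Rs (rails m) ⟩
        (a , p) ∷ (b , q) ∷ Rs ++ (Rg ++ [ rung (suc m) ]) ++ edges X
          ≡⟨ cong (λ es → (a , p) ∷ (b , q) ∷ es)
                  (trans (cong (Rs ++_) (++-assoc Rg [ rung (suc m) ] (edges X))) (sym (++-assoc Rs Rg _))) ⟩
        (a , p) ∷ (b , q) ∷ (Rs ++ Rg) ++ rung (suc m) ∷ edges X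
          ↭⟨ ↭.prep (a , p) (↭.prep (b , q) (shift (rung (suc m)) (Rs ++ Rg) (edges X))) ⟩
        (a , p) ∷ (b , q) ∷ rung (suc m) ∷ (Rs ++ Rg) ++ edges X
          ∎

      cycles-↭ : cycles (ladder (suc m)) ++ cycles X ↭ square m ∷ Sq ++ cycles X
      cycles-↭ = begin
        map square (upTo (suc m)) ++ cycles X  ≡⟨ cong (_++ cycles X) (map-upTo-suc square m) ⟩
        (Sq ++ [ square m ]) ++ cycles X       ≡⟨ ++-assoc Sq [ square m ] (cycles X) ⟩
        Sq ++ square m ∷ cycles X              ↭⟨ shift (square m) Sq (cycles X) ⟩
        square m ∷ Sq ++ cycles X              ∎

  f-ladder-suc-∪ : ∀ k → f k (ladder (suc m) ∪ X)
                         ≡ f k (ladder m ∪ X) + fWith (columnCover m) k (ladder m ∪ X)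
                           + atPred (λ j → fWith (columnCover m) j (ladder m ∪ X)) k
  f-ladder-suc-∪ k = begin
    f k (ladder (suc m) ∪ X)
      ≡⟨ f≡fWith-uncovered k (ladder (suc m) ∪ X) ⟩
    fWith uncovered k (ladder (suc m) ∪ X)
      ≡⟨ fWith-↭ᴳ uncovered k ladder-suc-↭ ⟩
    fWith uncovered k extended
      ≡⟨ f-extended k ⟩
    fWith uncovered k H + covered k + atPred covered k
      ≡⟨ cong (λ n → n + covered k + atPred covered k) (f≡fWith-uncovered k H) ⟨
    f k H + covered k + atPred covered k
      ∎
    where
    open ≡-Reasoning
    H = ladder m ∪ X
    covered : ℕ → ℕ
    covered j = fWith (columnCover m) j H

  fWith-columnCover-ladder-suc-∪ : ∀ k → fWith (columnCover (suc m)) k (ladder (suc m) ∪ X) ≡ f k (ladder m ∪ X)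
  fWith-columnCover-ladder-suc-∪ k = begin
    fWith (columnCover (suc m)) k (ladder (suc m) ∪ X)  ≡⟨ fWith-↭ᴳ (columnCover (suc m)) k ladder-suc-↭ ⟩
    fWith (columnCover (suc m)) k extended              ≡⟨ f-extended-covered k ⟩
    fWith uncovered k (ladder m ∪ X)                    ≡⟨ f≡fWith-uncovered k (ladder m ∪ X) ⟨
    f k (ladder m ∪ X)                                  ∎
    where open ≡-Reasoning

shiftVertex : Vertex → Vertex
shiftVertex v = (suc (proj₁ v) , proj₂ v)

shiftVertex-injective : Injective _≡_ _≡_ shiftVertex
shiftVertex-injective eq = cong (λ v → (ℕ.pred (proj₁ v) , proj₂ v)) eq

shiftEdge : Edge → Edge
shiftEdge = ×.map shiftVertex shiftVertex

shiftGraph : PlaneGraph → PlaneGraph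
shiftGraph G = record
  { vertices = map shiftVertex (vertices G)
  ; edges    = map shiftEdge (edges G)
  ; cycles   = map (map shiftVertex) (cycles G)
  }

fWith-shiftGraph : ∀ pre k G → fWith pre k (shiftGraph G) ≡ fWith (pre ∘ shiftVertex) k G
fWith-shiftGraph pre k G = tilings-rename shiftVertex-injective (vertices G) (edges G) (cycles G) k pre

NotInColumn0 : Vertex → Set
NotInColumn0 v = 1 ≤ proj₁ v

shiftGraph-inside : ∀ G → Inside NotInColumn0 (shiftGraph G)
shiftGraph-inside G =
    All-map⁺ (All.universal (λ _ → s≤s z≤n) (vertices G))
  , All-map⁺ (All.universal (λ _ → s≤s z≤n , s≤s z≤n) (edges G))
  , All-map⁺ (All.universal (λ c → All-map⁺ (All.universal (λ _ → s≤s z≤n) c)) (cycles G))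

NotInColumn0⇒≢-column0 : ∀ {v} z → NotInColumn0 v → v ≢ (0 , z)
NotInColumn0⇒≢-column0 z () refl

concatMap-applyUpTo-suc : ∀ (g : ℕ → List A) (s : A → A) → (∀ j → g (suc j) ≡ map s (g j)) →
                          ∀ n → concatMap g (applyUpTo suc n) ≡ map s (concatMap g (upTo n))
concatMap-applyUpTo-suc g s g∘suc≗ n = begin
  concatMap g (applyUpTo suc n)    ≡⟨ cong (concatMap g) (map-upTo suc n) ⟨
  concatMap g (map suc (upTo n))   ≡⟨ concatMap-map g suc (upTo n) ⟩
  concatMap (g ∘ suc) (upTo n)     ≡⟨ concatMap-cong g∘suc≗ (upTo n) ⟩
  concatMap (map s ∘ g) (upTo n)   ≡⟨ map-concatMap s g (upTo n) ⟨
  map s (concatMap g (upTo n))     ∎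
  where open ≡-Reasoning

map-applyUpTo-suc : ∀ (g : ℕ → A) (s : A → A) → (∀ j → g (suc j) ≡ s (g j)) →
                    ∀ n → map g (applyUpTo suc n) ≡ map s (map g (upTo n))
map-applyUpTo-suc g s g∘suc≗ n = begin
  map g (applyUpTo suc n)   ≡⟨ cong (map g) (map-upTo suc n) ⟨
  map g (map suc (upTo n))  ≡⟨ map-∘ (upTo n) ⟨
  map (g ∘ suc) (upTo n)    ≡⟨ map-cong g∘suc≗ (upTo n) ⟩
  map (s ∘ g) (upTo n)      ≡⟨ map-∘ (upTo n) ⟩
  map s (map g (upTo n))    ∎
  where open ≡-Reasoning

module LeftEnd (m : ℕ) (X : PlaneGraph) where

  private
    p q a b : Vertex
    p = (0 , + 0)
    q = (0 , + 1)
    a = (1 , + 0)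
    b = (1 , + 1)

    corners : ∀ v → inCycle v (square 0) ≡ ((v =ᵛ p) ∨ (v =ᵛ q)) ∨ ((v =ᵛ a) ∨ (v =ᵛ b))
    corners v = solve 4 (λ x y z w → x :+ (z :+ (w :+ (y :+ con false))) := (x :+ y) :+ (z :+ w)) refl
                  (v =ᵛ p) (v =ᵛ q) (v =ᵛ a) (v =ᵛ b)
      where open ∨-∧-Solver

  open AddColumn (shiftGraph (ladder m ∪ X)) NotInColumn0 (shiftGraph-inside (ladder m ∪ X))
                 p q a b (rung 0) (p , a) (q , b) (square 0)
                 (NotInColumn0⇒≢-column0 (+ 0)) (NotInColumn0⇒≢-column0 (+ 1)) (λ ()) (λ ()) (λ ()) (λ ())
                 (λ _ → refl) (λ _ → refl) (λ _ → refl) corners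

  private
    ladder-suc-↭ : ladder (suc m) ∪ shiftGraph X ↭ᴳ extended
    ladder-suc-↭ = ↭.↭-reflexive vertices-≡ , edges-↭ , ↭.↭-reflexive cycles-≡
      where
      open PermutationReasoning
      L  = concatMap column (upTo (suc m))
      Rs = concatMap rails (upTo m)
      Rg = map rung (upTo (suc m))
      Sq = map square (upTo m)
      Rs′ = concatMap rails (applyUpTo suc m)
      Rg′ = map rung (applyUpTo suc (suc m))

      vertices-≡ : p ∷ q ∷ concatMap column (applyUpTo suc (suc m)) ++ map shiftVertex (vertices X)
                   ≡ p ∷ q ∷ map shiftVertex (L ++ vertices X)
      vertices-≡ = cong (λ vs → p ∷ q ∷ vs) (trans
        (cong (_++ map shiftVertex (vertices X)) (concatMap-applyUpTo-suc column shiftVertex (λ _ → refl) (suc m)))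
        (sym (map-++ shiftVertex L (vertices X))))

      edges-↭ : (p , a) ∷ (q , b) ∷ (Rs′ ++ rung 0 ∷ Rg′) ++ map shiftEdge (edges X)
                ↭ (p , a) ∷ (q , b) ∷ rung 0 ∷ map shiftEdge ((Rs ++ Rg) ++ edges X)
      edges-↭ = ↭.prep (p , a) (↭.prep (q , b) (begin
        (Rs′ ++ rung 0 ∷ Rg′) ++ map shiftEdge (edges X)    ≡⟨ ++-assoc Rs′ (rung 0 ∷ Rg′) _ ⟩
        Rs′ ++ rung 0 ∷ Rg′ ++ map shiftEdge (edges X)      ↭⟨ shift (rung 0) Rs′ _ ⟩
        rung 0 ∷ Rs′ ++ Rg′ ++ map shiftEdge (edges X)      ≡⟨ cong (rung 0 ∷_) shifted ⟩
        rung 0 ∷ map shiftEdge ((Rs ++ Rg) ++ edges X)      ∎))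
        where
        shifted : Rs′ ++ Rg′ ++ map shiftEdge (edges X) ≡ map shiftEdge ((Rs ++ Rg) ++ edges X)
        shifted = trans (cong₂ (λ xs ys → xs ++ ys ++ map shiftEdge (edges X))
                               (concatMap-applyUpTo-suc rails shiftEdge (λ _ → refl) m)
                               (map-applyUpTo-suc rung shiftEdge (λ _ → refl) (suc m)))
          (trans (cong (map shiftEdge Rs ++_) (sym (map-++ shiftEdge Rg (edges X))))
          (trans (sym (map-++ shiftEdge Rs (Rg ++ edges X)))
                 (cong (map shiftEdge) (sym (++-assoc Rs Rg (edges X))))))

      cycles-≡ : square 0 ∷ map square (applyUpTo suc m) ++ map (map shiftVertex) (cycles X)
                 ≡ square 0 ∷ map (map shiftVertex) (Sq ++ cycles X)
      cycles-≡ = cong (square 0 ∷_) (trans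
        (cong (_++ map (map shiftVertex) (cycles X)) (map-applyUpTo-suc square (map shiftVertex) (λ _ → refl) m))
        (sym (map-++ (map shiftVertex) Sq (cycles X))))

    column1≗column0 : ∀ v → pairCover a b (shiftVertex v) ≡ columnCover 0 v
    column1≗column0 v = cong₂ _+_ (cong toℕ (=ᵛ-injective shiftVertex-injective v p))
                                  (cong toℕ (=ᵛ-injective shiftVertex-injective v q))

  f-ladder-suc-∪-shiftGraph : ∀ k → f k (ladder (suc m) ∪ shiftGraph X)
                                    ≡ f k (ladder m ∪ X) + fWith (columnCover 0) k (ladder m ∪ X)
                                      + atPred (λ j → fWith (columnCover 0) j (ladder m ∪ X)) k
  f-ladder-suc-∪-shiftGraph k = begin
    f k (ladder (suc m) ∪ shiftGraph X)
      ≡⟨ f≡fWith-uncovered k (ladder (suc m) ∪ shiftGraph X) ⟩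
    fWith uncovered k (ladder (suc m) ∪ shiftGraph X)
      ≡⟨ fWith-↭ᴳ uncovered k ladder-suc-↭ ⟩
    fWith uncovered k extended
      ≡⟨ f-extended k ⟩
    fWith uncovered k (shiftGraph H) + shifted k + atPred shifted k
      ≡⟨ cong₂ (λ x y → x + y + atPred shifted k) (fWith-shiftGraph uncovered k H) (shifted≡covered k) ⟩
    fWith uncovered k H + covered k + atPred shifted k
      ≡⟨ cong₂ (λ x y → x + covered k + y) (sym (f≡fWith-uncovered k H)) (atPred-cong shifted≡covered k) ⟩
    f k H + covered k + atPred covered k
      ∎
    where
    open ≡-Reasoning
    H = ladder m ∪ X
    shifted covered : ℕ → ℕ
    shifted j = fWith (pairCover a b) j (shiftGraph H)
    covered j = fWith (columnCover 0) j H
    shifted≡covered : ∀ j → shifted j ≡ covered j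
    shifted≡covered j = trans (fWith-shiftGraph (pairCover a b) j H)
      (tilings-cover-cong (vertices H) (edges H) (cycles H) j (All.universal column1≗column0 (vertices H)))

  fWith-columnCover-ladder-suc-∪-shiftGraph : ∀ k →
    fWith (columnCover 0) k (ladder (suc m) ∪ shiftGraph X) ≡ f k (ladder m ∪ X)
  fWith-columnCover-ladder-suc-∪-shiftGraph k = begin
    fWith (columnCover 0) k (ladder (suc m) ∪ shiftGraph X)  ≡⟨ fWith-↭ᴳ (columnCover 0) k ladder-suc-↭ ⟩
    fWith (columnCover 0) k extended                         ≡⟨ f-extended-covered k ⟩
    fWith uncovered k (shiftGraph (ladder m ∪ X))            ≡⟨ fWith-shiftGraph uncovered k (ladder m ∪ X) ⟩
    fWith uncovered k (ladder m ∪ X)                         ≡⟨ f≡fWith-uncovered k (ladder m ∪ X) ⟨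
    f k (ladder m ∪ X)                                       ∎
    where open ≡-Reasoning

ladder-∪-recurrence : ∀ n X → Inside (Within n) X → ∀ k →
                      f k (ladder (2 + n) ∪ X) ≡ f k (ladder (1 + n) ∪ X) + f k (ladder n ∪ X) + fPred k (ladder n ∪ X)
ladder-∪-recurrence n X X≤n =
  recurrence (ladder (2 + n) ∪ X) (ladder (1 + n) ∪ X) (ladder n ∪ X) (columnCover (1 + n))
  (RightEnd.f-ladder-suc-∪ (1 + n) X (Inside-mono (λ v≤n → ≤-trans v≤n (n≤1+n n)) X≤n))
  (RightEnd.fWith-columnCover-ladder-suc-∪ n X X≤n)

ladder-∪-shiftGraph-recurrence : ∀ n X k →
  f k (ladder (2 + n) ∪ shiftGraph (shiftGraph X))
    ≡ f k (ladder (1 + n) ∪ shiftGraph X) + f k (ladder n ∪ X) + fPred k (ladder n ∪ X)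
ladder-∪-shiftGraph-recurrence n X =
  recurrence (ladder (2 + n) ∪ shiftGraph (shiftGraph X)) (ladder (1 + n) ∪ shiftGraph X) (ladder n ∪ X) (columnCover 0)
  (LeftEnd.f-ladder-suc-∪-shiftGraph (1 + n) (shiftGraph X))
  (LeftEnd.fWith-columnCover-ladder-suc-∪-shiftGraph n X)

ladder-recurrence : ∀ n k → f k (ladder (2 + n)) ≡ f k (ladder (1 + n)) + f k (ladder n) + fPred k (ladder n)
ladder-recurrence n k = begin
  f k (ladder (2 + n))
    ≡⟨ cong (f k) (∪-emptyGraph (ladder (2 + n))) ⟨
  f k (ladder (2 + n) ∪ emptyGraph)
    ≡⟨ ladder-∪-recurrence n emptyGraph ([] , [] , []) k ⟩
  f k (ladder (1 + n) ∪ emptyGraph) + f k (ladder n ∪ emptyGraph) + fPred k (ladder n ∪ emptyGraph)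
    ≡⟨ cong₂ (λ G H → f k G + f k H + fPred k H) (∪-emptyGraph (ladder (1 + n))) (∪-emptyGraph (ladder n)) ⟩
  f k (ladder (1 + n)) + f k (ladder n) + fPred k (ladder n)
    ∎
  where open ≡-Reasoning

ladderSq-shifted-recurrence : ∀ n i → 3 ≤ i → ∀ k →
  f k (ladderSq (2 + n) i) ≡ f k (ladderSq (1 + n) (i ∸ 1)) + f k (ladderSq n (i ∸ 2)) + fPred k (ladderSq n (i ∸ 2))
ladderSq-shifted-recurrence n (suc (suc (suc j))) (s≤s (s≤s (s≤s _))) =
  ladder-∪-shiftGraph-recurrence n (lowerSquare (suc j))

proposition4p1 : (n : ℕ) → 1 ≤ n → (k : ℕ) →
      (f k (ladder (n + 2)) ≡ f k (ladder (n + 1)) + f k (ladder n) + fPred k (ladder n))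
    × ((i : ℕ) → 1 ≤ i → i ≤ n →
        f k (ladderSq (n + 2) i) ≡ f k (ladderSq (n + 1) i) + f k (ladderSq n i) + fPred k (ladderSq n i))
    × ((i : ℕ) → 3 ≤ i → i ≤ n + 2 →
        f k (ladderSq (n + 2) i) ≡ f k (ladderSq (n + 1) (i ∸ 1)) + f k (ladderSq n (i ∸ 2)) + fPred k (ladderSq n (i ∸ 2)))
proposition4p1 n _ k rewrite +-comm n 2 | +-comm n 1 =
    ladder-recurrence n k
  , (λ i _ i≤n → ladder-∪-recurrence n (lowerSquare i) (lowerSquare-within i≤n) k)
  , (λ i 3≤i _ → ladderSq-shifted-recurrence n i 3≤i k)
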